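{- Let $U$ be an even integral unimodular lattice, let $\Upsilon=\frac{1}{\sqrt 2}U$, let $M,N$ be a polarization of $\Upsilon$, and let $k\ge 2$ be an integer. Let $L_M$, $L^N$ and $L(M,N,k)$ be as defined in the context. Then: (i) $L(M,N,k)$ is an integral lattice and the sublattice $L_M$ is even; (ii) if $k$ is even or $N$ is an even lattice, then $L(M,N,k)$ is an even lattice; otherwise $L(M,N,k)$ is odd (integral but not even); (iii) $L(M,N,k)$ is unimodular.
   Context: All lattices are positive definite rational lattices (inner products take rational values). Let $U$ be an even integral unimodular lattice and $\Upsilon=\frac{1}{\sqrt2}U$ (so $U=\sqrt2\,\Upsilon$). A polarization of $\Upsilon$ is a pair of sublattices $M,N\subseteq\Upsilon$, each integral (i.e. $(M,M)\subseteq\mathbb Z$, $(N,N)\subseteq\mathbb Z$), with $M+N=\Upsilon$ and $M\cap N=2\Upsilon$. For $k\ge2$, inside the orthogonal direct sum $\Upsilon^k$ define $L_M=\{(x_1,\dots,x_k)\in M^k : x_1+\cdots+x_k\in M\cap N\}$, $L^N=\{(y,y,\dots,y): y\in N\}$ and $L(M,N,k)=L_M+L^N$. -}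

module Defs where

open import Data.Nat as ℕ using (ℕ; zero; suc)
open import Data.Integer as ℤ using (ℤ)
open import Data.Rational as ℚ using (ℚ; 0ℚ; ½; _/_)
open import Data.Fin using (Fin)
open import Data.Vec as V using (Vec; []; _∷_; zipWith; replicate; foldr; lookup; map)
open import Data.Vec.Relation.Unary.All using (All)
open import Data.Product using (Σ; ∃; _×_; _,_)
open import Relation.Binary.PropositionalEquality using (_≡_)
open import Relation.Nullary using (¬_)
open import Relation.Unary using (Pred)
open import Level using (0ℓ)

IsInt : ℚ → Set
IsInt q = ∃ λ (z : ℤ) → q ≡ z / 1

IsEvenInt : ℚ → Set
IsEvenInt q = ∃ λ (z : ℤ) → q ≡ (ℤ.+ 2 ℤ.* z) / 1

-- The ambient rational vector space ℚ^n (vectors as Vec, so that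
-- pointwise-equal vectors are propositionally equal)

ℚVec : ℕ → Set
ℚVec n = Vec ℚ n

_⊕_ : ∀ {n} → ℚVec n → ℚVec n → ℚVec n
_⊕_ = zipWith ℚ._+_

sc : ∀ {n} → ℚ → ℚVec n → ℚVec n
sc c = map (c ℚ.*_)

zeroV : ∀ {n} → ℚVec n
zeroV = replicate _ 0ℚ

ΣF : ∀ n → (Fin n → ℚ) → ℚ
ΣF zero    f = 0ℚ
ΣF (suc n) f = f Fin.zero ℚ.+ ΣF n (λ i → f (Fin.suc i))
  where import Data.Fin as Fin

form : ∀ {n} → (Fin n → Fin n → ℚ) → ℚVec n → ℚVec n → ℚ
form {n} G x y = ΣF n λ i → ΣF n λ j → lookup x i ℚ.* G i j ℚ.* lookup y j

PosDef : ∀ {n} → (Fin n → Fin n → ℚ) → Set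
PosDef {n} G = ∀ (x : ℚVec n) → ¬ (x ≡ zeroV) → 0ℚ ℚ.< form G x x

Symmetric : ∀ {n} → (Fin n → Fin n → ℚ) → Set
Symmetric G = ∀ i j → G i j ≡ G j i

-- All lattices below have full rank in the ambient
-- space, so the dual lattice is taken inside the ambient space.

module _ {A : Set} (B : A → A → ℚ) where

  Integral : Pred A 0ℓ → Set
  Integral L = ∀ x y → L x → L y → IsInt (B x y)

  EvenLat : Pred A 0ℓ → Set
  EvenLat L = ∀ x → L x → IsEvenInt (B x x)

  OddLat : Pred A 0ℓ → Set
  OddLat L = Integral L × ¬ EvenLat L

  Dual : Pred A 0ℓ → Pred A 0ℓ
  Dual L x = ∀ y → L y → IsInt (B x y)

  Unimodular : Pred A 0ℓ → Set
  Unimodular L = (∀ x → L x → Dual L x) × (∀ x → Dual L x → L x)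

-- The lattice Υ = ℤ^n ⊆ ℚ^n.  U is ℤ^n with Gram matrix G, and
-- Υ = (1/√2) U is ℤ^n with Gram matrix G/2.

Υ : ∀ {n} → Pred (ℚVec n) 0ℓ
Υ = All IsInt

formU : ∀ {n} → (Fin n → Fin n → ℚ) → ℚVec n → ℚVec n → ℚ
formU G = form G

formΥ : ∀ {n} → (Fin n → Fin n → ℚ) → ℚVec n → ℚVec n → ℚ
formΥ G x y = ½ ℚ.* form G x y

twoΥ : ∀ {n} → Pred (ℚVec n) 0ℓ
twoΥ x = ∃ λ y → Υ y × x ≡ sc (ℤ.+ 2 / 1) y

record Sublattice {n} (S : Pred (ℚVec n) 0ℓ) : Set where
  field
    ⊆Υ   : ∀ x → S x → Υ x
    zero∈ : S zeroV
    +∈   : ∀ x y → S x → S y → S (x ⊕ y)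
    -∈   : ∀ x → S x → S (map ℚ.-_ x)

record Polarization {n} (G : Fin n → Fin n → ℚ) (M N : Pred (ℚVec n) 0ℓ) : Set where
  field
    subM   : Sublattice M
    subN   : Sublattice N
    intM   : Integral (formΥ G) M
    intN   : Integral (formΥ G) N
    sumΥ   : ∀ x → Υ x → ∃ λ m → ∃ λ m' → M m × N m' × x ≡ m ⊕ m'
    cap⊆   : ∀ x → M x → N x → twoΥ x
    ⊆cap   : ∀ x → twoΥ x → M x × N x

formΥk : ∀ {n k} → (Fin n → Fin n → ℚ) → Vec (ℚVec n) k → Vec (ℚVec n) k → ℚ
formΥk {k = k} G X Y = ΣF k λ a → formΥ G (lookup X a) (lookup Y a)

sumV : ∀ {n k} → Vec (ℚVec n) k → ℚVec n
sumV = foldr _ _⊕_ zeroV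

module _ {n : ℕ} (M N : Pred (ℚVec n) 0ℓ) (k : ℕ) where

  L_M : Pred (Vec (ℚVec n) k) 0ℓ
  L_M X = All M X × (M (sumV X) × N (sumV X))

  L^N : Pred (Vec (ℚVec n) k) 0ℓ
  L^N X = ∃ λ y → N y × X ≡ replicate k y

  LMNk : Pred (Vec (ℚVec n) k) 0ℓ
  LMNk X = ∃ λ P → ∃ λ Q → L_M P × L^N Q × X ≡ zipWith _⊕_ P Q

{-# OPTIONS --safe #-}
-- Write Σ X for the sum of the coordinates of X ∈ Υᵏ.  For P ∈ L_M the coordinates lie in the
-- integral lattice M, so (ΣP, ΣP) − (P, P) is twice a sum of integral cross terms; since
-- ΣP ∈ M ∩ N = 2Υ, (ΣP, ΣP) is even, hence so is (P, P).  Against (y, …, y) every X pairs as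
-- (ΣX, y), which is integral because ΣP ∈ N for P ∈ L_M; and ((y, …, y), (y, …, y)) = k (y, y)
-- is what decides the parity of L.
--
-- For unimodularity the key point is that M and N are self-dual inside Υ: if x = m + n is
-- integral against M, then n is integral against all of Υ = M + N, so n ∈ 2Υ ⊆ M because U
-- is unimodular.  An X in the dual of L has coordinates in Υ (pair with 2u in a single slot)
-- and pairwise differences in M (pair with (−m, …, m, …)); writing x₁ = m + y, the vector
-- X − (y, …, y) lies in Mᵏ, and its coordinate sum lies in N by self-duality of N.
module Submission where

open import Defs
open import Algebra.Bundles using (AbelianGroup; CommutativeMonoid)
open import Algebra.Structures using (IsAbelianGroup)
import Algebra.Properties.CommutativeSemigroup as CommutativeSemigroupProperties
import Algebra.Properties.Group as GroupProperties
open import Data.Nat using (ℕ; _≤_; zero; suc; s≤s)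
import Data.Nat as ℕ
open import Data.Nat.Divisibility using (_∣_; divides)
open import Data.Integer as ℤ using (ℤ)
import Data.Integer.Properties as ℤP
import Data.Integer.Solver as ℤSolver
open import Data.Rational as ℚ using (ℚ; 0ℚ; 1ℚ; ½; _/_; _+_; _*_; -_; _-_)
import Data.Rational.Properties as ℚP
open import Data.Rational.Unnormalised as ℚᵘ using (mkℚᵘ; *≡*)
import Data.Rational.Unnormalised.Properties as ℚᵘP
import Data.Rational.Solver as ℚSolver
open import Data.Fin using (Fin) renaming (zero to fzero; suc to fsuc)
open import Data.Vec using (Vec; []; _∷_; zipWith; replicate; lookup; map)
import Data.Vec.Properties as VecP
open import Data.Vec.Relation.Unary.All as All using (All; []; _∷_)
import Data.Vec.Relation.Unary.All.Properties as AllP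
open import Data.Product using (∃; _×_; _,_; proj₁; proj₂)
open import Data.Sum using (_⊎_; inj₁; inj₂)
open import Relation.Binary.PropositionalEquality
open import Relation.Nullary using (¬_)
open import Relation.Unary using (Pred)
open import Level using (0ℓ)

ι : ℤ → ℚ
ι z = z / 1

ι≃mkℚᵘ : ∀ z → ℚ.toℚᵘ (ι z) ℚᵘ.≃ mkℚᵘ z 0
ι≃mkℚᵘ z = ℚP.toℚᵘ-fromℚᵘ (mkℚᵘ z 0)

ι-+ : ∀ a b → ι (a ℤ.+ b) ≡ ι a + ι b
ι-+ a b = ℚP.toℚᵘ-injective (begin
  ℚ.toℚᵘ (ι (a ℤ.+ b))               ≈⟨ ι≃mkℚᵘ (a ℤ.+ b) ⟩
  mkℚᵘ (a ℤ.+ b) 0                   ≈⟨ *≡* (cong (ℤ._* ℤ.+ 1) (cong₂ ℤ._+_ (sym (ℤP.*-identityʳ a)) (sym (ℤP.*-identityʳ b)))) ⟩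
  mkℚᵘ a 0 ℚᵘ.+ mkℚᵘ b 0             ≈⟨ ℚᵘP.+-cong (ι≃mkℚᵘ a) (ι≃mkℚᵘ b) ⟨
  ℚ.toℚᵘ (ι a) ℚᵘ.+ ℚ.toℚᵘ (ι b)     ≈⟨ ℚP.toℚᵘ-homo-+ (ι a) (ι b) ⟨
  ℚ.toℚᵘ (ι a + ι b)                 ∎)
  where open ℚᵘP.≃-Reasoning

ι-* : ∀ a b → ι (a ℤ.* b) ≡ ι a * ι b
ι-* a b = ℚP.toℚᵘ-injective (begin
  ℚ.toℚᵘ (ι (a ℤ.* b))               ≈⟨ ι≃mkℚᵘ (a ℤ.* b) ⟩
  mkℚᵘ a 0 ℚᵘ.* mkℚᵘ b 0             ≈⟨ ℚᵘP.*-cong (ι≃mkℚᵘ a) (ι≃mkℚᵘ b) ⟨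
  ℚ.toℚᵘ (ι a) ℚᵘ.* ℚ.toℚᵘ (ι b)     ≈⟨ ℚP.toℚᵘ-homo-* (ι a) (ι b) ⟨
  ℚ.toℚᵘ (ι a * ι b)                 ∎)
  where open ℚᵘP.≃-Reasoning

ι-neg : ∀ a → ι (ℤ.- a) ≡ - ι a
ι-neg a = ℚP.toℚᵘ-injective (begin
  ℚ.toℚᵘ (ι (ℤ.- a))                 ≈⟨ ι≃mkℚᵘ (ℤ.- a) ⟩
  ℚᵘ.- mkℚᵘ a 0                      ≈⟨ ℚᵘP.-‿cong (ι≃mkℚᵘ a) ⟨
  ℚᵘ.- ℚ.toℚᵘ (ι a)                  ≈⟨ ℚP.toℚᵘ-homo‿- (ι a) ⟨
  ℚ.toℚᵘ (- ι a)                     ∎)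
  where open ℚᵘP.≃-Reasoning

ι-injective : ∀ {a b} → ι a ≡ ι b → a ≡ b
ι-injective {a} {b} e
  with *≡* p ← ℚᵘP.≃-trans (ℚᵘP.≃-sym (ι≃mkℚᵘ a)) (ℚᵘP.≃-trans (ℚP.toℚᵘ-cong e) (ι≃mkℚᵘ b))
  = trans (sym (ℤP.*-identityʳ a)) (trans p (ℤP.*-identityʳ b))

IsInt-0 : IsInt 0ℚ
IsInt-0 = ℤ.+ 0 , refl

IsInt-+ : ∀ {p q} → IsInt p → IsInt q → IsInt (p + q)
IsInt-+ (a , refl) (b , refl) = a ℤ.+ b , sym (ι-+ a b)

IsInt-neg : ∀ {p} → IsInt p → IsInt (- p)
IsInt-neg (a , refl) = ℤ.- a , sym (ι-neg a)

IsInt-sub : ∀ {p q} → IsInt p → IsInt q → IsInt (p - q)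
IsInt-sub p q = IsInt-+ p (IsInt-neg q)

IsInt-cancelˡ : ∀ {a c} → IsInt a → IsInt (a + c) → IsInt c
IsInt-cancelˡ {a} {c} Ia Iac = subst IsInt (solve 2 (λ a c → (a :+ c) :- a := c) refl a c) (IsInt-sub Iac Ia)
  where open ℚSolver.+-*-Solver

IsInt-cancelʳ : ∀ {a c} → IsInt c → IsInt (a + c) → IsInt a
IsInt-cancelʳ {a} {c} Ic Iac = IsInt-cancelˡ Ic (subst IsInt (ℚP.+-comm a c) Iac)

IsEvenInt-0 : IsEvenInt 0ℚ
IsEvenInt-0 = ℤ.+ 0 , refl

IsEvenInt-+ : ∀ {p q} → IsEvenInt p → IsEvenInt q → IsEvenInt (p + q)
IsEvenInt-+ (a , refl) (b , refl) = a ℤ.+ b ,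
  trans (sym (ι-+ (ℤ.+ 2 ℤ.* a) (ℤ.+ 2 ℤ.* b))) (cong ι (sym (ℤP.*-distribˡ-+ (ℤ.+ 2) a b)))

IsEvenInt-neg : ∀ {p} → IsEvenInt p → IsEvenInt (- p)
IsEvenInt-neg (a , refl) = ℤ.- a ,
  trans (sym (ι-neg (ℤ.+ 2 ℤ.* a))) (cong ι (ℤP.neg-distribʳ-* (ℤ.+ 2) a))

IsEvenInt-sub : ∀ {p q} → IsEvenInt p → IsEvenInt q → IsEvenInt (p - q)
IsEvenInt-sub p q = IsEvenInt-+ p (IsEvenInt-neg q)

2ℚ : ℚ
2ℚ = ι (ℤ.+ 2)

IsEvenInt-2* : ∀ {p} → IsInt p → IsEvenInt (2ℚ * p)
IsEvenInt-2* (a , refl) = a , sym (ι-* (ℤ.+ 2) a)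

module Biadditive {A : Set} (_∙_ : A → A → A) (f : A → A → ℚ)
  (f-∙ˡ : ∀ x y z → f (x ∙ y) z ≡ f x z + f y z) (f-comm : ∀ x y → f x y ≡ f y x) where
  open ℚSolver.+-*-Solver

  f-∙ʳ : ∀ x y z → f z (x ∙ y) ≡ f z x + f z y
  f-∙ʳ x y z = trans (f-comm z (x ∙ y)) (trans (f-∙ˡ x y z) (cong₂ _+_ (f-comm x z) (f-comm y z)))

  f-expand : ∀ p q p′ q′ → f (p ∙ q) (p′ ∙ q′) ≡ (f p p′ + f p q′) + (f q p′ + f q q′)
  f-expand p q p′ q′ = trans (f-∙ˡ p q (p′ ∙ q′)) (cong₂ _+_ (f-∙ʳ p′ q′ p) (f-∙ʳ p′ q′ q))

  f-square : ∀ p q → f (p ∙ q) (p ∙ q) ≡ f p p + 2ℚ * f p q + f q q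
  f-square p q = begin
    f (p ∙ q) (p ∙ q)                      ≡⟨ f-expand p q p q ⟩
    (f p p + f p q) + (f q p + f q q)      ≡⟨ cong (λ t → (f p p + f p q) + (t + f q q)) (f-comm q p) ⟩
    (f p p + f p q) + (f p q + f q q)      ≡⟨ solve 3 (λ a c d → (a :+ c) :+ (c :+ d) := a :+ con 2ℚ :* c :+ d) refl (f p p) (f p q) (f q q) ⟩
    f p p + 2ℚ * f p q + f q q             ∎
    where open ≡-Reasoning

+-interchange : ∀ a b c d → (a + b) + (c + d) ≡ (a + c) + (b + d)
+-interchange = CommutativeSemigroupProperties.interchange
  (CommutativeMonoid.commutativeSemigroup ℚP.+-0-commutativeMonoid)

ΣF-cong : ∀ n {f h : Fin n → ℚ} → (∀ i → f i ≡ h i) → ΣF n f ≡ ΣF n h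
ΣF-cong zero    e = refl
ΣF-cong (suc n) e = cong₂ _+_ (e fzero) (ΣF-cong n (λ i → e (fsuc i)))

ΣF-0 : ∀ n → ΣF n (λ _ → 0ℚ) ≡ 0ℚ
ΣF-0 zero    = refl
ΣF-0 (suc n) = cong (0ℚ +_) (ΣF-0 n)

ΣF-+ : ∀ n (f h : Fin n → ℚ) → ΣF n (λ i → f i + h i) ≡ ΣF n f + ΣF n h
ΣF-+ zero    f h = refl
ΣF-+ (suc n) f h = trans (cong (f fzero + h fzero +_) (ΣF-+ n _ _))
  (+-interchange (f fzero) (h fzero) (ΣF n (λ i → f (fsuc i))) (ΣF n (λ i → h (fsuc i))))

ΣF-*ˡ : ∀ n (c : ℚ) (f : Fin n → ℚ) → ΣF n (λ i → c * f i) ≡ c * ΣF n f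
ΣF-*ˡ zero    c f = sym (ℚP.*-zeroʳ c)
ΣF-*ˡ (suc n) c f = trans (cong (c * f fzero +_) (ΣF-*ˡ n c _)) (sym (ℚP.*-distribˡ-+ c (f fzero) _))

ΣF-swap : ∀ n m (f : Fin n → Fin m → ℚ) →
  ΣF n (λ i → ΣF m (f i)) ≡ ΣF m (λ j → ΣF n (λ i → f i j))
ΣF-swap zero    m f = sym (ΣF-0 m)
ΣF-swap (suc n) m f = trans (cong (ΣF m (f fzero) +_) (ΣF-swap n m (λ i → f (fsuc i))))
  (sym (ΣF-+ m (f fzero) (λ j → ΣF n (λ i → f (fsuc i) j))))

zipWith-isAbelianGroup : ∀ {A : Set} {_∙_ : A → A → A} {ε : A} {_⁻¹ : A → A} →
  IsAbelianGroup _≡_ _∙_ ε _⁻¹ → ∀ n →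
  IsAbelianGroup _≡_ (zipWith {n = n} _∙_) (replicate n ε) (map _⁻¹)
zipWith-isAbelianGroup isAbGrp n = record
  { isGroup = record
    { isMonoid = record
      { isSemigroup = record
        { isMagma = record { isEquivalence = isEquivalence ; ∙-cong = cong₂ _ }
        ; assoc = VecP.zipWith-assoc assoc }
      ; identity = VecP.zipWith-identityˡ identityˡ , VecP.zipWith-identityʳ identityʳ }
    ; inverse = VecP.zipWith-inverseˡ inverseˡ , VecP.zipWith-inverseʳ inverseʳ
    ; ⁻¹-cong = cong _ }
  ; comm = VecP.zipWith-comm comm }
  where open IsAbelianGroup isAbGrp using (assoc; identityˡ; identityʳ; inverseˡ; inverseʳ; comm)

ℚⁿ-abelianGroup : ℕ → AbelianGroup 0ℓ 0ℓ
ℚⁿ-abelianGroup n = record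
  { isAbelianGroup = zipWith-isAbelianGroup ℚP.+-0-isAbelianGroup n }

infixl 6 _⊖_
_⊖_ : ∀ {n} → ℚVec n → ℚVec n → ℚVec n
x ⊖ y = x ⊕ map -_ y

module _ {n : ℕ} where
  open AbelianGroup (ℚⁿ-abelianGroup n) using (group; assoc)
  open GroupProperties group using (//-rightDividesˡ; //-rightDividesʳ; \\-leftDividesʳ)

  ⊕-identityˡ : (x : ℚVec n) → zeroV ⊕ x ≡ x
  ⊕-identityˡ = VecP.zipWith-identityˡ ℚP.+-identityˡ

  ⊕-identityʳ : (x : ℚVec n) → x ⊕ zeroV ≡ x
  ⊕-identityʳ = VecP.zipWith-identityʳ ℚP.+-identityʳ

  ⊕-inverseˡ : (x : ℚVec n) → map -_ x ⊕ x ≡ zeroV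
  ⊕-inverseˡ = VecP.zipWith-inverseˡ ℚP.+-inverseˡ

  ⊖-⊕-cancel : (x y : ℚVec n) → (x ⊖ y) ⊕ y ≡ x
  ⊖-⊕-cancel x y = //-rightDividesˡ y x

  ⊕-⊖-cancel : (x y : ℚVec n) → (x ⊕ y) ⊖ y ≡ x
  ⊕-⊖-cancel x y = //-rightDividesʳ y x

  ⊖-telescope : (x y z : ℚVec n) → x ⊖ z ≡ (x ⊖ y) ⊕ (y ⊖ z)
  ⊖-telescope x y z = sym (begin
    (x ⊖ y) ⊕ (y ⊖ z)          ≡⟨ assoc x (map -_ y) (y ⊖ z) ⟩
    x ⊕ (map -_ y ⊕ (y ⊖ z))   ≡⟨ cong (x ⊕_) (\\-leftDividesʳ y (map -_ z)) ⟩
    x ⊖ z                      ∎)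
    where open ≡-Reasoning

⊕-comm : ∀ {n} (x y : ℚVec n) → x ⊕ y ≡ y ⊕ x
⊕-comm = VecP.zipWith-comm ℚP.+-comm

sc-½-inverse : ∀ {n} (x : ℚVec n) → sc 2ℚ (sc ½ x) ≡ x
sc-½-inverse x = begin
  sc 2ℚ (sc ½ x)          ≡⟨ VecP.map-∘ (2ℚ *_) (½ *_) x ⟨
  map (λ q → 2ℚ * (½ * q)) x ≡⟨ VecP.map-cong (solve 1 (λ q → con 2ℚ :* (con ½ :* q) := q) refl) x ⟩
  map (λ q → q) x         ≡⟨ VecP.map-id x ⟩
  x                       ∎
  where
  open ≡-Reasoning
  open ℚSolver.+-*-Solver

module Forms {n : ℕ} (G : Fin n → Fin n → ℚ) (symG : Symmetric G) where
  open ℚSolver.+-*-Solver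

  g b : ℚVec n → ℚVec n → ℚ
  g = form G
  b = formΥ G

  private
    entry : ℚVec n → ℚVec n → Fin n → Fin n → ℚ
    entry x y i j = lookup x i * G i j * lookup y j

  g-+ˡ : ∀ x y z → g (x ⊕ y) z ≡ g x z + g y z
  g-+ˡ x y z = trans (ΣF-cong n λ i → trans (ΣF-cong n (split i)) (ΣF-+ n _ _)) (ΣF-+ n _ _)
    where
    split : ∀ i j → entry (x ⊕ y) z i j ≡ entry x z i j + entry y z i j
    split i j = trans (cong (λ t → t * G i j * lookup z j) (VecP.lookup-zipWith _+_ i x y))
      (solve 4 (λ a c h w → (a :+ c) :* h :* w := a :* h :* w :+ c :* h :* w) refl
        (lookup x i) (lookup y i) (G i j) (lookup z j))

  g-*ˡ : ∀ c x z → g (sc c x) z ≡ c * g x z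
  g-*ˡ c x z = trans (ΣF-cong n λ i → trans (ΣF-cong n (pull i)) (ΣF-*ˡ n c _)) (ΣF-*ˡ n c _)
    where
    pull : ∀ i j → entry (sc c x) z i j ≡ c * entry x z i j
    pull i j = trans (cong (λ t → t * G i j * lookup z j) (VecP.lookup-map i (c *_) x))
      (solve 4 (λ c a h w → (c :* a) :* h :* w := c :* (a :* h :* w)) refl
        c (lookup x i) (G i j) (lookup z j))

  g-comm : ∀ x y → g x y ≡ g y x
  g-comm x y = trans (ΣF-swap n n (entry x y)) (ΣF-cong n λ j → ΣF-cong n (flip j))
    where
    flip : ∀ j i → entry x y i j ≡ entry y x j i
    flip j i = trans (cong (λ t → lookup x i * t * lookup y j) (symG i j))
      (solve 3 (λ a h w → a :* h :* w := w :* h :* a) refl (lookup x i) (G j i) (lookup y j))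

  g-0ˡ : ∀ z → g zeroV z ≡ 0ℚ
  g-0ˡ z = begin
    g zeroV z              ≡⟨ cong (λ v → g v z) (sym (trans (VecP.map-replicate (0ℚ *_) 0ℚ n) (cong (replicate n) (ℚP.*-zeroˡ 0ℚ)))) ⟩
    g (sc 0ℚ zeroV) z      ≡⟨ g-*ˡ 0ℚ zeroV z ⟩
    0ℚ * g zeroV z         ≡⟨ ℚP.*-zeroˡ (g zeroV z) ⟩
    0ℚ                     ∎
    where open ≡-Reasoning

  g-negˡ : ∀ x z → g (map -_ x) z ≡ - g x z
  g-negˡ x z = begin
    g (map -_ x) z         ≡⟨ cong (λ v → g v z) (VecP.map-cong minus-one x) ⟩
    g (sc (- 1ℚ) x) z      ≡⟨ g-*ˡ (- 1ℚ) x z ⟩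
    - 1ℚ * g x z           ≡⟨ minus-one (g x z) ⟨
    - g x z                ∎
    where
    open ≡-Reasoning
    minus-one : ∀ q → - q ≡ - 1ℚ * q
    minus-one q = solve 1 (λ q → :- q := :- con 1ℚ :* q) refl q

  b-+ˡ : ∀ x y z → b (x ⊕ y) z ≡ b x z + b y z
  b-+ˡ x y z = trans (cong (½ *_) (g-+ˡ x y z)) (ℚP.*-distribˡ-+ ½ (g x z) (g y z))

  b-comm : ∀ x y → b x y ≡ b y x
  b-comm x y = cong (½ *_) (g-comm x y)

  open Biadditive _⊕_ b b-+ˡ b-comm public
    using () renaming (f-∙ʳ to b-+ʳ; f-square to b-square)

  b-0ˡ : ∀ z → b zeroV z ≡ 0ℚ
  b-0ˡ z = trans (cong (½ *_) (g-0ˡ z)) (ℚP.*-zeroʳ ½)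

  b-0ʳ : ∀ z → b z zeroV ≡ 0ℚ
  b-0ʳ z = trans (b-comm z zeroV) (b-0ˡ z)

  b-negˡ : ∀ x z → b (map -_ x) z ≡ - b x z
  b-negˡ x z = trans (cong (½ *_) (g-negˡ x z)) (sym (ℚP.neg-distribʳ-* ½ (g x z)))

  b-neg-swap : ∀ x z → b (map -_ x) z ≡ b x (map -_ z)
  b-neg-swap x z = begin
    b (map -_ x) z         ≡⟨ b-negˡ x z ⟩
    - b x z                ≡⟨ cong -_ (b-comm x z) ⟩
    - b z x                ≡⟨ b-negˡ z x ⟨
    b (map -_ z) x         ≡⟨ b-comm (map -_ z) x ⟩
    b x (map -_ z)         ∎
    where open ≡-Reasoning

  b-2ʳ : ∀ x u → b x (sc 2ℚ u) ≡ g x u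
  b-2ʳ x u = begin
    ½ * g x (sc 2ℚ u)      ≡⟨ cong (½ *_) (trans (g-comm x (sc 2ℚ u)) (g-*ˡ 2ℚ u x)) ⟩
    ½ * (2ℚ * g u x)       ≡⟨ solve 1 (λ a → con ½ :* (con 2ℚ :* a) := a) refl (g u x) ⟩
    g u x                  ≡⟨ g-comm u x ⟩
    g x u                  ∎
    where open ≡-Reasoning

single : ∀ {n k} → Fin k → ℚVec n → Vec (ℚVec n) k
single fzero    v = v ∷ replicate _ zeroV
single (fsuc a) v = zeroV ∷ single a v

sumV-replicate-zero : ∀ {n} k → sumV (replicate k (zeroV {n})) ≡ zeroV
sumV-replicate-zero zero    = refl
sumV-replicate-zero (suc k) = trans (cong (zeroV ⊕_) (sumV-replicate-zero k)) (⊕-identityˡ zeroV)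

sumV-single : ∀ {n k} (a : Fin k) (v : ℚVec n) → sumV (single a v) ≡ v
sumV-single {k = suc k} fzero    v = trans (cong (v ⊕_) (sumV-replicate-zero k)) (⊕-identityʳ v)
sumV-single (fsuc a) v = trans (⊕-identityˡ _) (sumV-single a v)

module OrthogonalSum {n : ℕ} (G : Fin n → Fin n → ℚ) (symG : Symmetric G) where
  open Forms G symG

  infixl 6 _⊞_
  _⊞_ : ∀ {k} → Vec (ℚVec n) k → Vec (ℚVec n) k → Vec (ℚVec n) k
  _⊞_ = zipWith _⊕_

  B : ∀ {k} → Vec (ℚVec n) k → Vec (ℚVec n) k → ℚ
  B = formΥk G

  B-+ˡ : ∀ {k} (P Q Z : Vec (ℚVec n) k) → B (P ⊞ Q) Z ≡ B P Z + B Q Z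
  B-+ˡ []      []      []      = refl
  B-+ˡ (p ∷ P) (q ∷ Q) (z ∷ Z) =
    trans (cong₂ _+_ (b-+ˡ p q z) (B-+ˡ P Q Z)) (+-interchange (b p z) (b q z) (B P Z) (B Q Z))

  B-comm : ∀ {k} (P Q : Vec (ℚVec n) k) → B P Q ≡ B Q P
  B-comm []      []      = refl
  B-comm (p ∷ P) (q ∷ Q) = cong₂ _+_ (b-comm p q) (B-comm P Q)

  module _ {k : ℕ} where
    open Biadditive (_⊞_ {k}) B B-+ˡ B-comm public
      using () renaming (f-expand to B-expand; f-square to B-square)

  B-replicateʳ : ∀ {k} (X : Vec (ℚVec n) k) y → B X (replicate k y) ≡ b (sumV X) y
  B-replicateʳ []      y = sym (b-0ˡ y)
  B-replicateʳ (x ∷ X) y = trans (cong (b x y +_) (B-replicateʳ X y)) (sym (b-+ˡ x (sumV X) y))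

  B-replicate-self : ∀ k y z → b y y ≡ ι z → B (replicate k y) (replicate k y) ≡ ι (ℤ.+ k ℤ.* z)
  B-replicate-self zero    y z _  = cong ι (sym (ℤP.*-zeroˡ z))
  B-replicate-self (suc k) y z yy = begin
    b y y + B (replicate k y) (replicate k y)   ≡⟨ cong₂ _+_ yy (B-replicate-self k y z yy) ⟩
    ι z + ι (ℤ.+ k ℤ.* z)                       ≡⟨ ι-+ z (ℤ.+ k ℤ.* z) ⟨
    ι (z ℤ.+ ℤ.+ k ℤ.* z)                       ≡⟨ cong ι (solve 2 (λ k z → z :+ k :* z := (con (ℤ.+ 1) :+ k) :* z) refl (ℤ.+ k) z) ⟩
    ι (ℤ.+ (suc k) ℤ.* z)                       ∎
    where
    open ≡-Reasoning
    open ℤSolver.+-*-Solver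

  B-singleʳ : ∀ {k} (X : Vec (ℚVec n) k) a v → B X (single a v) ≡ b (lookup X a) v
  B-singleʳ (x ∷ X) fzero    v = begin
    b x v + B X (replicate _ zeroV)  ≡⟨ cong (b x v +_) (trans (B-replicateʳ X zeroV) (b-0ʳ (sumV X))) ⟩
    b x v + 0ℚ                       ≡⟨ ℚP.+-identityʳ (b x v) ⟩
    b x v                            ∎
    where open ≡-Reasoning
  B-singleʳ (x ∷ X) (fsuc a) v = begin
    b x zeroV + B X (single a v)     ≡⟨ cong₂ _+_ (b-0ʳ x) (B-singleʳ X a v) ⟩
    0ℚ + b (lookup X a) v            ≡⟨ ℚP.+-identityˡ _ ⟩
    b (lookup X a) v                 ∎
    where open ≡-Reasoning


All-replicate : ∀ {a} {A : Set a} {S : Pred A 0ℓ} k {y} → S y → All S (replicate k y)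
All-replicate zero    Sy = []
All-replicate (suc k) Sy = Sy ∷ All-replicate k Sy

module _ {n : ℕ} {S : Pred (ℚVec n) 0ℓ} (subS : Sublattice S) where
  open Sublattice subS

  Sublattice-sumV : ∀ {k} {X : Vec (ℚVec n) k} → All S X → S (sumV X)
  Sublattice-sumV []         = zero∈
  Sublattice-sumV (Sx ∷ SX) = +∈ _ _ Sx (Sublattice-sumV SX)

Polarization-sym : ∀ {n} {G : Fin n → Fin n → ℚ} {M N} → Polarization G M N → Polarization G N M
Polarization-sym pol = record
  { subM = subN ; subN = subM ; intM = intN ; intN = intM
  ; sumΥ = λ x Υx → let (m , y , Mm , Ny , x≡m⊕y) = sumΥ x Υx in y , m , Ny , Mm , trans x≡m⊕y (⊕-comm m y)
  ; cap⊆ = λ x Nx Mx → cap⊆ x Mx Nx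
  ; ⊆cap = λ x 2Υx → let (Mx , Nx) = ⊆cap x 2Υx in Nx , Mx }
  where open Polarization pol

module Duality {n : ℕ} (G : Fin n → Fin n → ℚ) (symG : Symmetric G)
  (uniU : Unimodular (formU G) Υ) where
  open Forms G symG

  twoΥ-fromDual : ∀ t → Dual b Υ t → twoΥ t
  twoΥ-fromDual t t* = sc ½ t , proj₂ uniU (sc ½ t) ½t* , sym (sc-½-inverse t)
    where
    ½t* : Dual g Υ (sc ½ t)
    ½t* u Υu = subst IsInt (sym (g-*ˡ ½ t u)) (t* u Υu)

  module _ {M N : Pred (ℚVec n) 0ℓ} (pol : Polarization G M N) where
    open Polarization pol
    open Sublattice subM using (+∈)

    Polarization-selfDual : ∀ x → Υ x → Dual b M x → M x
    Polarization-selfDual x Υx x* with sumΥ x Υx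
    ... | m , y , Mm , Ny , refl = +∈ m y Mm (proj₁ (⊆cap y (twoΥ-fromDual y y*)))
      where
      y* : Dual b Υ y
      y* u Υu with sumΥ u Υu
      ... | m′ , y′ , Mm′ , Ny′ , refl = subst IsInt (sym (b-+ʳ m′ y′ y)) (IsInt-+ ym′ (intN y y′ Ny Ny′))
        where
        ym′ : IsInt (b y m′)
        ym′ = IsInt-cancelˡ (intM m m′ Mm Mm′) (subst IsInt (b-+ˡ m y m′) (x* m′ Mm′))

even-or-odd : ∀ k → 2 ∣ k ⊎ ∃ λ j → k ≡ suc (j ℕ.* 2)
even-or-odd zero    = inj₁ (divides 0 refl)
even-or-odd (suc k) with even-or-odd k
... | inj₁ (divides j k≡j*2) = inj₂ (j , cong suc k≡j*2)
... | inj₂ (j , k≡1+j*2)     = inj₁ (divides (suc j) (cong suc k≡1+j*2))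

module Parity where
  open ℤSolver.+-*-Solver

  even*-even : ∀ j z → ℤ.+ (j ℕ.* 2) ℤ.* z ≡ ℤ.+ 2 ℤ.* (ℤ.+ j ℤ.* z)
  even*-even j z = trans (cong (ℤ._* z) (ℤP.pos-* j 2))
    (solve 2 (λ j z → (j :* con (ℤ.+ 2)) :* z := con (ℤ.+ 2) :* (j :* z)) refl (ℤ.+ j) z)

  *even-even : ∀ k w → ℤ.+ k ℤ.* (ℤ.+ 2 ℤ.* w) ≡ ℤ.+ 2 ℤ.* (ℤ.+ k ℤ.* w)
  *even-even k w = solve 2 (λ k w → k :* (con (ℤ.+ 2) :* w) := con (ℤ.+ 2) :* (k :* w)) refl (ℤ.+ k) w

  odd*-even⇒even : ∀ j z w → ℤ.+ (suc (j ℕ.* 2)) ℤ.* z ≡ ℤ.+ 2 ℤ.* w → z ≡ ℤ.+ 2 ℤ.* (w ℤ.- ℤ.+ j ℤ.* z)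
  odd*-even⇒even j z w kz≡2w = begin
    z                                                  ≡⟨ solve 2 (λ j z → z := (con (ℤ.+ 1) :+ j :* con (ℤ.+ 2)) :* z :- con (ℤ.+ 2) :* (j :* z)) refl (ℤ.+ j) z ⟩
    (ℤ.+ 1 ℤ.+ ℤ.+ j ℤ.* ℤ.+ 2) ℤ.* z ℤ.- ℤ.+ 2 ℤ.* (ℤ.+ j ℤ.* z)
        ≡⟨ cong (λ t → t ℤ.* z ℤ.- ℤ.+ 2 ℤ.* (ℤ.+ j ℤ.* z)) (sym odd) ⟩
    ℤ.+ (suc (j ℕ.* 2)) ℤ.* z ℤ.- ℤ.+ 2 ℤ.* (ℤ.+ j ℤ.* z)
        ≡⟨ cong (ℤ._- ℤ.+ 2 ℤ.* (ℤ.+ j ℤ.* z)) kz≡2w ⟩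
    ℤ.+ 2 ℤ.* w ℤ.- ℤ.+ 2 ℤ.* (ℤ.+ j ℤ.* z)            ≡⟨ solve 3 (λ j z w → con (ℤ.+ 2) :* w :- con (ℤ.+ 2) :* (j :* z) := con (ℤ.+ 2) :* (w :- j :* z)) refl (ℤ.+ j) z w ⟩
    ℤ.+ 2 ℤ.* (w ℤ.- ℤ.+ j ℤ.* z)                     ∎
    where
    open ≡-Reasoning
    odd : ℤ.+ (suc (j ℕ.* 2)) ≡ ℤ.+ 1 ℤ.+ ℤ.+ j ℤ.* ℤ.+ 2
    odd = trans (ℤP.pos-+ 1 (j ℕ.* 2)) (cong (λ t → ℤ.+ 1 ℤ.+ t) (ℤP.pos-* j 2))

Υ-⊕ : ∀ {n} {x y : ℚVec n} → Υ x → Υ y → Υ (x ⊕ y)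
Υ-⊕ []         []         = []
Υ-⊕ (Ix ∷ Υx) (Iy ∷ Υy) = IsInt-+ Ix Iy ∷ Υ-⊕ Υx Υy

Υ-⊖ : ∀ {n} {x y : ℚVec n} → Υ x → Υ y → Υ (x ⊖ y)
Υ-⊖ Υx Υy = Υ-⊕ Υx (AllP.map⁺ (All.map IsInt-neg Υy))

shift-cancel : ∀ {n k} (X : Vec (ℚVec n) k) y → zipWith _⊕_ (map (_⊖ y) X) (replicate k y) ≡ X
shift-cancel []      y = refl
shift-cancel (x ∷ X) y = cong₂ _∷_ (⊖-⊕-cancel x y) (shift-cancel X y)

All-single : ∀ {n k} {S : Pred (ℚVec n) 0ℓ} {v} → S zeroV → (a : Fin k) → S v → All S (single a v)
All-single S0 fzero    Sv = Sv ∷ All-replicate _ S0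
All-single S0 (fsuc a) Sv = S0 ∷ All-single S0 a Sv

module Lattice {n : ℕ} (G : Fin n → Fin n → ℚ) (symG : Symmetric G)
  (intU : Integral (formU G) Υ) (uniU : Unimodular (formU G) Υ)
  (M N : Pred (ℚVec n) 0ℓ) (pol : Polarization G M N) where
  open Forms G symG
  open OrthogonalSum G symG
  open Duality G symG uniU
  open Polarization pol
  open Sublattice subM using (+∈) renaming (⊆Υ to M⊆Υ; zero∈ to M-zero; -∈ to M-neg)
  open Sublattice subN using () renaming (zero∈ to N-zero)

  M-selfDual : ∀ x → Υ x → Dual b M x → M x
  M-selfDual = Polarization-selfDual pol

  N-selfDual : ∀ x → Υ x → Dual b N x → N x
  N-selfDual = Polarization-selfDual (Polarization-sym pol)

  L_M⊆L : ∀ {k X} → L_M M N k X → LMNk M N k X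
  L_M⊆L {k} {X} X∈L_M =
    X , replicate k zeroV , X∈L_M , (zeroV , N-zero , refl) , sym (VecP.zipWith-identityʳ ⊕-identityʳ X)

  L^N⊆L : ∀ {k y} → N y → LMNk M N k (replicate k y)
  L^N⊆L {k} {y} Ny =
    replicate k zeroV , replicate k y , 0∈L_M , (y , Ny , refl) , sym (VecP.zipWith-identityˡ ⊕-identityˡ _)
    where
    0∈L_M : L_M M N k (replicate k zeroV)
    0∈L_M = All-replicate k M-zero
          , subst M (sym (sumV-replicate-zero k)) M-zero , subst N (sym (sumV-replicate-zero k)) N-zero

  single∈L_M : ∀ {k} (a : Fin k) {v} → M v → N v → L_M M N k (single a v)
  single∈L_M a {v} Mv Nv =
    All-single M-zero a Mv , subst M (sym (sumV-single a v)) Mv , subst N (sym (sumV-single a v)) Nv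

  B-M-integral : ∀ {k} {P P′ : Vec (ℚVec n) k} → All M P → All M P′ → IsInt (B P P′)
  B-M-integral []         []           = IsInt-0
  B-M-integral (Mp ∷ MP) (Mp′ ∷ MP′) = IsInt-+ (intM _ _ Mp Mp′) (B-M-integral MP MP′)

  B-replicate-integral : ∀ {k} (X : Vec (ℚVec n) k) {y} → N (sumV X) → N y → IsInt (B X (replicate k y))
  B-replicate-integral X {y} NΣX Ny = subst IsInt (sym (B-replicateʳ X y)) (intN _ _ NΣX Ny)

  L-integral : ∀ {k} → Integral B (LMNk M N k)
  L-integral {k} _ _ (P , _ , (MP , _ , NΣP) , (y , Ny , refl) , refl)
                     (P′ , _ , (MP′ , _ , NΣP′) , (y′ , Ny′ , refl) , refl) =
    subst IsInt (sym (B-expand P Q P′ Q′))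
      (IsInt-+ (IsInt-+ (B-M-integral MP MP′) (B-replicate-integral P NΣP Ny′))
               (IsInt-+ (subst IsInt (B-comm P′ Q) (B-replicate-integral P′ NΣP′ Ny))
                        (B-replicate-integral Q NΣQ Ny′)))
    where
    Q = replicate k y
    Q′ = replicate k y′
    NΣQ : N (sumV Q)
    NΣQ = Sublattice-sumV subN (All-replicate k Ny)

  sumV-square-even : ∀ {k} {P : Vec (ℚVec n) k} → All M P → IsEvenInt (b (sumV P) (sumV P) - B P P)
  sumV-square-even [] = subst IsEvenInt (sym (trans (cong (_- 0ℚ) (b-0ˡ zeroV)) (ℚP.+-inverseʳ 0ℚ))) IsEvenInt-0
  sumV-square-even {P = p ∷ P} (Mp ∷ MP) = subst IsEvenInt (sym step)
      (IsEvenInt-+ (IsEvenInt-2* (intM p s Mp (Sublattice-sumV subM MP))) (sumV-square-even MP))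
    where
    s = sumV P
    open ℚSolver.+-*-Solver
    step : b (p ⊕ s) (p ⊕ s) - (b p p + B P P) ≡ 2ℚ * b p s + (b s s - B P P)
    step = trans (cong (_- (b p p + B P P)) (b-square p s))
      (solve 4 (λ a c d e → (a :+ con 2ℚ :* c :+ d) :- (a :+ e) := con 2ℚ :* c :+ (d :- e)) refl
        (b p p) (b p s) (b s s) (B P P))

  L_M-even : ∀ {k} → EvenLat B (L_M M N k)
  L_M-even P (MP , MΣP , NΣP) with cap⊆ (sumV P) MΣP NΣP
  ... | u , Υu , ΣP≡2u =
    subst IsEvenInt (sub-sub-cancel (b (sumV P) (sumV P)) (B P P)) (IsEvenInt-sub ΣP²-even (sumV-square-even MP))
    where
    open ℚSolver.+-*-Solver
    sub-sub-cancel : ∀ a c → a - (a - c) ≡ c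
    sub-sub-cancel = solve 2 (λ a c → a :- (a :- c) := c) refl
    ΣP²-even : IsEvenInt (b (sumV P) (sumV P))
    ΣP²-even = subst IsEvenInt (sym (trans (cong₂ b ΣP≡2u ΣP≡2u) (trans (b-2ʳ (sc 2ℚ u) u) (g-*ˡ 2ℚ u u))))
      (IsEvenInt-2* (intU u u Υu Υu))

  replicate-square-even : ∀ {k y} → 2 ∣ k ⊎ EvenLat b N → N y → IsEvenInt (B (replicate k y) (replicate k y))
  replicate-square-even {k} {y} (inj₁ (divides j refl)) Ny =
    let (z , yy) = intN y y Ny Ny in
    ℤ.+ j ℤ.* z , trans (B-replicate-self k y z yy) (cong ι (Parity.even*-even j z))
  replicate-square-even {k} {y} (inj₂ N-even) Ny =
    let (w , yy) = N-even y Ny in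
    ℤ.+ k ℤ.* w , trans (B-replicate-self k y _ yy) (cong ι (Parity.*even-even k w))

  L-even : ∀ {k} → 2 ∣ k ⊎ EvenLat b N → EvenLat B (LMNk M N k)
  L-even {k} even _ (P , _ , P∈L_M@(_ , _ , NΣP) , (y , Ny , refl) , refl) =
    subst IsEvenInt (sym (B-square P (replicate k y)))
      (IsEvenInt-+ (IsEvenInt-+ (L_M-even P P∈L_M) (IsEvenInt-2* (B-replicate-integral P NΣP Ny)))
                   (replicate-square-even even Ny))

  L-odd : ∀ {k} → ¬ (2 ∣ k ⊎ EvenLat b N) → OddLat B (LMNk M N k)
  L-odd {k} not-even = L-integral , λ L-ev → not-even (even-condition L-ev)
    where
    even-condition : EvenLat B (LMNk M N k) → 2 ∣ k ⊎ EvenLat b N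
    even-condition L-ev with even-or-odd k
    ... | inj₁ 2∣k        = inj₁ 2∣k
    ... | inj₂ (j , refl) = inj₂ λ y Ny →
      let (z , yy) = intN y y Ny Ny
          (w , ky²) = L-ev (replicate k y) (L^N⊆L Ny)
          kz≡2w = ι-injective (trans (sym (B-replicate-self k y z yy)) ky²)
      in w ℤ.- ℤ.+ j ℤ.* z , trans yy (cong ι (Parity.odd*-even⇒even j z w kz≡2w))

  dual-entry-Υ : ∀ {k} (X : Vec (ℚVec n) k) → Dual B (LMNk M N k) X → ∀ a → Υ (lookup X a)
  dual-entry-Υ X X* a = proj₂ uniU (lookup X a) λ u Υu →
    let (M2u , N2u) = ⊆cap (sc 2ℚ u) (u , Υu , refl) in
    subst IsInt (trans (B-singleʳ X a (sc 2ℚ u)) (b-2ʳ (lookup X a) u))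
      (X* (single a (sc 2ℚ u)) (L_M⊆L (single∈L_M a M2u N2u)))

  dual-difference-M : ∀ {k} x (X : Vec (ℚVec n) k) → Dual B (LMNk M N (suc k)) (x ∷ X) →
                      ∀ a → M (lookup X a ⊖ x)
  dual-difference-M {k} x X X* a =
    M-selfDual _ (Υ-⊖ (dual-entry-Υ (x ∷ X) X* (fsuc a)) (dual-entry-Υ (x ∷ X) X* fzero)) λ m Mm →
      subst IsInt (sym (pairing m)) (X* (map -_ m ∷ single a m) (L_M⊆L (D∈L_M Mm)))
    where
    D∈L_M : ∀ {m} → M m → L_M M N (suc k) (map -_ m ∷ single a m)
    D∈L_M {m} Mm = M-neg m Mm ∷ All-single M-zero a Mm , subst M (sym ΣD≡0) M-zero , subst N (sym ΣD≡0) N-zero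
      where
      ΣD≡0 : map -_ m ⊕ sumV (single a m) ≡ zeroV
      ΣD≡0 = trans (cong (map -_ m ⊕_) (sumV-single a m)) (⊕-inverseˡ m)
    pairing : ∀ m → b (lookup X a ⊖ x) m ≡ B (x ∷ X) (map -_ m ∷ single a m)
    pairing m = begin
      b (lookup X a ⊖ x) m                  ≡⟨ b-+ˡ (lookup X a) (map -_ x) m ⟩
      b (lookup X a) m + b (map -_ x) m     ≡⟨ ℚP.+-comm (b (lookup X a) m) (b (map -_ x) m) ⟩
      b (map -_ x) m + b (lookup X a) m     ≡⟨ cong₂ _+_ (b-neg-swap x m) (sym (B-singleʳ X a m)) ⟩
      b x (map -_ m) + B X (single a m)     ∎
      where open ≡-Reasoning

  dual-decomposition∈L : ∀ {k} x (X : Vec (ℚVec n) k) → Dual B (LMNk M N (suc k)) (x ∷ X) →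
                         (∃ λ m → ∃ λ y → M m × N y × x ≡ m ⊕ y) → LMNk M N (suc k) (x ∷ X)
  dual-decomposition∈L {k} x X X* (m , y , Mm , Ny , x≡m⊕y) =
    P , Y , (MP , MΣP , NΣP) , (y , Ny , refl) , sym (shift-cancel (x ∷ X) y)
    where
    Y = replicate (suc k) y
    P = map (_⊖ y) (x ∷ X)
    x⊖y∈M : M (x ⊖ y)
    x⊖y∈M = subst M (sym (trans (cong (_⊖ y) x≡m⊕y) (⊕-⊖-cancel m y))) Mm
    shift∈M : ∀ z → M (z ⊖ x) → M (z ⊖ y)
    shift∈M z Mz = subst M (sym (⊖-telescope z x y)) (+∈ (z ⊖ x) (x ⊖ y) Mz x⊖y∈M)
    MP : All M P
    MP = x⊖y∈M ∷ AllP.map⁺ (subst (All (λ z → M (z ⊖ y))) (VecP.tabulate∘lookup X)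
                  (AllP.tabulate⁺ λ a → shift∈M (lookup X a) (dual-difference-M x X X* a)))
    MΣP : M (sumV P)
    MΣP = Sublattice-sumV subM MP
    NΣY : N (sumV Y)
    NΣY = Sublattice-sumV subN (All-replicate (suc k) Ny)
    X-pairing : ∀ y′ → N y′ → IsInt (B P (replicate (suc k) y′) + B Y (replicate (suc k) y′))
    X-pairing y′ Ny′ = subst IsInt (trans (cong (λ Z → B Z (replicate (suc k) y′)) (sym (shift-cancel (x ∷ X) y)))
                                          (B-+ˡ P Y (replicate (suc k) y′)))
                             (X* (replicate (suc k) y′) (L^N⊆L Ny′))
    NΣP : N (sumV P)
    NΣP = N-selfDual (sumV P) (M⊆Υ (sumV P) MΣP) λ y′ Ny′ →
      subst IsInt (B-replicateʳ P y′) (IsInt-cancelʳ (B-replicate-integral Y NΣY Ny′) (X-pairing y′ Ny′))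

  dual⊆L : ∀ {k} X → Dual B (LMNk M N (suc k)) X → LMNk M N (suc k) X
  dual⊆L (x ∷ X) X* = dual-decomposition∈L x X X* (sumΥ x (dual-entry-Υ (x ∷ X) X* fzero))

  L-unimodular : ∀ {k} → Unimodular B (LMNk M N (suc k))
  L-unimodular = (λ X L∋X Y L∋Y → L-integral X Y L∋X L∋Y) , dual⊆L

proposition2p8 : (n : ℕ) (G : Fin n → Fin n → ℚ) →
    Symmetric G → PosDef G →
    Integral (formU G) Υ → EvenLat (formU G) Υ → Unimodular (formU G) Υ →
    (M N : Pred (ℚVec n) 0ℓ) → Polarization G M N →
    (k : ℕ) → 2 ≤ k →
    (Integral (formΥk G) (LMNk M N k) × EvenLat (formΥk G) (L_M M N k))
    × (((2 ∣ k ⊎ EvenLat (formΥ G) N) → EvenLat (formΥk G) (LMNk M N k))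
       × (¬ (2 ∣ k ⊎ EvenLat (formΥ G) N) → OddLat (formΥk G) (LMNk M N k)))
    × Unimodular (formΥk G) (LMNk M N k)
proposition2p8 n G symG _ intU _ uniU M N pol (suc k) (s≤s _) =
  (L-integral , L_M-even) , (L-even , L-odd) , L-unimodular
  where open Lattice G symG intU uniU M N pol
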